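{- For every integer $m\geq 3$, $\lambda_1^1(P_m \times C_7)=5$.
   Context: For a graph $G$, an $L(1,1)$-labeling with labels in $\{0,1,\dots,p\}$ is a function $l:V(G)\to\{0,1,\dots,p\}$ such that $l(u)\neq l(v)$ whenever the distance $d(u,v)$ is $1$ or $2$. $\lambda_1^1(G)$ denotes the least $p$ for which $G$ admits such a labeling. $P_m$ denotes the path with $m$ vertices and $C_n$ the cycle with $n$ vertices. The direct product $G\times H$ has vertex set $V(G)\times V(H)$, with $(x_1,x_2)$ adjacent to $(y_1,y_2)$ iff $x_1y_1\in E(G)$ and $x_2y_2\in E(H)$. -}

module Defs where

open import Data.Nat using (ℕ; zero; suc; _+_; _≤_; NonZero)
open import Data.Nat.DivMod using (_%_)
open import Data.Fin using (Fin; toℕ)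
open import Data.Product using (_×_; _,_; ∃; Σ)
open import Data.Sum using (_⊎_)
open import Relation.Nullary using (¬_)
open import Relation.Binary.PropositionalEquality using (_≡_)

record Graph : Set₁ where
  field
    V   : Set
    Adj : V → V → Set
open Graph public

PathAdj : ∀ {m} → Fin m → Fin m → Set
PathAdj i j = (suc (toℕ i) ≡ toℕ j) ⊎ (suc (toℕ j) ≡ toℕ i)

P : ℕ → Graph
P m = record { V = Fin m ; Adj = PathAdj }

CycleAdj : ∀ n → .{{_ : NonZero n}} → Fin n → Fin n → Set
CycleAdj n i j = ((suc (toℕ i)) % n ≡ toℕ j) ⊎ ((suc (toℕ j)) % n ≡ toℕ i)

C : ∀ n → .{{_ : NonZero n}} → Graph
C n = record { V = Fin n ; Adj = CycleAdj n }

-- Direct (tensor) product G × H.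
_⊗_ : Graph → Graph → Graph
G ⊗ H = record
  { V   = V G × V H
  ; Adj = λ { (x₁ , x₂) (y₁ , y₂) → Adj G x₁ y₁ × Adj H x₂ y₂ } }

-- d(u,v) ∈ {1,2}: u ≠ v and (u ~ v or u, v have a common neighbour).
Dist12 : (G : Graph) → V G → V G → Set
Dist12 G u v = ¬ (u ≡ v) × (Adj G u v ⊎ ∃ λ w → Adj G u w × Adj G w v)

IsL11Labeling : (G : Graph) (p : ℕ) → (V G → Fin (suc p)) → Set
IsL11Labeling G p l = ∀ u v → Dist12 G u v → ¬ (l u ≡ l v)

HasL11Labeling : Graph → ℕ → Set
HasL11Labeling G p = Σ (V G → Fin (suc p)) (IsL11Labeling G p)

Lambda11≡ : Graph → ℕ → Set
Lambda11≡ G p = HasL11Labeling G p × (∀ q → HasL11Labeling G q → p ≤ q)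

-- Upper bound: label row 0 by a seed s : ℤ₇ → ℤ₆ and obtain row i + 1 from row i by
-- shifting it one column and adding 1 to every label, i.e. l (i , j) = s (j + i) + i.
-- The distance-1 and distance-2 constraints between rows i, i + 1 and i + 2 are then the
-- same for every i, so they only have to be checked for s, a finite computation.
--
-- Lower bound: the first three rows of P_m × C₇ contain P₃ × C₇, which has 21 vertices,
-- while an exhaustive search shows that a set of vertices of P₃ × C₇ at pairwise distance
-- at least 3 has at most 4 elements.  Label classes are such sets, so five labels cover
-- at most 20 vertices.
module Submission where

open import Defs
open import Data.Nat using (ℕ; zero; suc; _+_; _*_; _≤_; _<_; _⊔_; _%_; z≤n; s≤s; NonZero)
open import Data.Nat.Properties
  using (≤-trans; <-irrefl; m≤m⊔n; m≤n⊔m; +-mono-≤; +-suc; *-monoˡ-≤; ≮⇒≥; suc-injective)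
import Data.Nat.Properties as ℕ
open import Data.Nat.DivMod using (_mod_; %-distribˡ-+; m%n%n≡m%n; [m+n]%n≡m%n; m<n⇒m%n≡m)
open import Data.Fin using (Fin; toℕ; inject≤; #_)
open import Data.Fin.Properties
  using (toℕ-fromℕ<; toℕ-inject≤; inject≤-injective; toℕ-injective; toℕ<n; all?; any?)
import Data.Fin.Properties as Fin
open import Data.Vec using ([]; _∷_; lookup)
open import Data.List using (List; []; _∷_; length; filter; allFin; cartesianProduct)
open import Data.List.Properties using (length-tabulate)
open import Data.List.Membership.Propositional using (_∈_)
open import Data.List.Membership.Propositional.Properties using (∈-allFin)
open import Data.List.Relation.Unary.Any using (here; there)
open import Data.List.Relation.Unary.All using (All; []; _∷_; universal)
import Data.List.Relation.Unary.All as All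
open import Data.List.Relation.Unary.All.Properties using (all-filter; filter⁺)
open import Data.List.Relation.Unary.AllPairs using (AllPairs; []; _∷_)
open import Data.List.Relation.Binary.Sublist.Propositional using (_⊆_; []; _∷_; _∷ʳ_; ⊆-trans)
open import Data.List.Relation.Binary.Sublist.Propositional.Properties using (filter-⊆)
open import Data.Product using (_×_; _,_; ∃; proj₁; proj₂)
import Data.Product.Properties as Product
open import Data.Sum using (inj₁; inj₂)
import Data.Sum as Sum
open import Data.Unit using (tt)
open import Function using (_∘_)
open import Relation.Nullary using (¬_; Dec; yes; no; ¬?; contradiction)
open import Relation.Nullary.Decidable using (_×-dec_; _⊎-dec_; _→-dec_; map′; toWitness)
open import Relation.Unary.Properties using (∁?)
import Relation.Unary as U
open import Relation.Binary using (Decidable; DecidableEquality)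
open import Relation.Binary.PropositionalEquality
  using (_≡_; _≢_; refl; sym; trans; cong; cong₂; module ≡-Reasoning)

private
  variable
    G G′ H : Graph
    m n p : ℕ

Far : (G : Graph) → V G → V G → Set
Far G u v = ¬ Dist12 G u v

record _↪_ (G H : Graph) : Set where
  field
    embed           : V G → V H
    embed-injective : ∀ {u v} → embed u ≡ embed v → u ≡ v
    embed-adjacent  : ∀ {u v} → Adj G u v → Adj H (embed u) (embed v)
open _↪_

Dist12-↪ : (e : G ↪ H) → ∀ {u v} → Dist12 G u v → Dist12 H (embed e u) (embed e v)
Dist12-↪ e (u≢v , near) =
  u≢v ∘ embed-injective e ,
  Sum.map (embed-adjacent e)
          (λ (w , uw , wv) → embed e w , embed-adjacent e uw , embed-adjacent e wv) near

HasL11Labeling-↪ : G ↪ H → HasL11Labeling H p → HasL11Labeling G p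
HasL11Labeling-↪ e (l , valid) = l ∘ embed e , λ u v d → valid _ _ (Dist12-↪ e d)

P-↪ : m ≤ n → P m ↪ P n
P-↪ m≤n = record
  { embed           = λ i → inject≤ i m≤n
  ; embed-injective = inject≤-injective m≤n m≤n _ _
  ; embed-adjacent  = adjacent
  }
  where
  adjacent : ∀ {i j} → PathAdj i j → PathAdj (inject≤ i m≤n) (inject≤ j m≤n)
  adjacent {i} {j} rewrite toℕ-inject≤ i m≤n | toℕ-inject≤ j m≤n = λ ij → ij

⊗-↪ˡ : G ↪ G′ → (G ⊗ H) ↪ (G′ ⊗ H)
⊗-↪ˡ {G} {G′} {H} e = record
  { embed           = embedˡ
  ; embed-injective = injective
  ; embed-adjacent  = adjacent
  }
  where
  embedˡ : V (G ⊗ H) → V (G′ ⊗ H)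
  embedˡ (x , y) = embed e x , y
  injective : ∀ {u v} → embedˡ u ≡ embedˡ v → u ≡ v
  injective {_ , _} {_ , _} eq = cong₂ _,_ (embed-injective e (cong proj₁ eq)) (cong proj₂ eq)
  adjacent : ∀ {u v} → Adj (G ⊗ H) u v → Adj (G′ ⊗ H) (embedˡ u) (embedˡ v)
  adjacent {_ , _} {_ , _} (xy , x′y′) = embed-adjacent e xy , x′y′

sameLabel⇒pairwiseFar : ∀ {l : V G → Fin (suc p)} {c vs} → IsL11Labeling G p l →
                        All (λ v → l v ≡ c) vs → AllPairs (Far G) vs
sameLabel⇒pairwiseFar valid []       = []
sameLabel⇒pairwiseFar valid (lv≡c ∷ same) =
  All.map (λ lw≡c d → valid _ _ d (trans lv≡c (sym lw≡c))) same ∷ sameLabel⇒pairwiseFar valid same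

PathAdj? : Decidable (PathAdj {m})
PathAdj? i j = (suc (toℕ i) ℕ.≟ toℕ j) ⊎-dec (suc (toℕ j) ℕ.≟ toℕ i)

CycleAdj? : ∀ n .{{_ : NonZero n}} → Decidable (CycleAdj n)
CycleAdj? n i j = (suc (toℕ i) % n ℕ.≟ toℕ j) ⊎-dec (suc (toℕ j) % n ℕ.≟ toℕ i)

⊗-Adj? : Decidable (Adj G) → Decidable (Adj H) → Decidable (Adj (G ⊗ H))
⊗-Adj? G? H? (x , y) (x′ , y′) = G? x x′ ×-dec H? y y′

Dist12? : DecidableEquality (V G) → Decidable (Adj G) →
          (∀ {P : V G → Set} → U.Decidable P → Dec (∃ P)) → Decidable (Dist12 G)
Dist12? _≟_ Adj? search u v =
  ¬? (u ≟ v) ×-dec (Adj? u v ⊎-dec search (λ w → Adj? u w ×-dec Adj? w v))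

searchFin² : ∀ {a b} {P : Fin a × Fin b → Set} → U.Decidable P → Dec (∃ P)
searchFin² P? = map′ (λ (i , j , pij) → (i , j) , pij) (λ ((i , j) , pij) → i , j , pij)
                     (any? λ i → any? λ j → P? (i , j))

module _ {A : Set} {P : A → Set} (P? : U.Decidable P) where

  length-filter+length-filter-∁ : ∀ xs →
                                  length (filter P? xs) + length (filter (∁? P?) xs) ≡ length xs
  length-filter+length-filter-∁ []       = refl
  length-filter+length-filter-∁ (x ∷ xs) with P? x
  ... | yes _ = cong suc (length-filter+length-filter-∁ xs)
  ... | no  _ = trans (+-suc _ _) (cong suc (length-filter+length-filter-∁ xs))

module _ {A B : Set} (_≟_ : DecidableEquality B) (f : A → B) {b : ℕ} where

  length≤classes*bound : ∀ cs {xs} → All (λ x → f x ∈ cs) xs →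
                         (∀ c {ys} → ys ⊆ xs → All (λ y → f y ≡ c) ys → length ys ≤ b) →
                         length xs ≤ length cs * b
  length≤classes*bound []       []            _     = z≤n
  length≤classes*bound (c ∷ cs) {xs} f∈c∷cs small = begin
    length xs                  ≡⟨ sym (length-filter+length-filter-∁ inClass? xs) ⟩
    length (filter inClass? xs) + length (filter (∁? inClass?) xs)
      ≤⟨ +-mono-≤ (small c (filter-⊆ inClass? xs) (all-filter inClass? xs))
                  (length≤classes*bound cs rest∈cs
                     λ c′ ys⊆rest → small c′ (⊆-trans ys⊆rest (filter-⊆ (∁? inClass?) xs))) ⟩
    b + length cs * b          ∎
    where
    open ℕ.≤-Reasoning
    inClass? : U.Decidable (λ x → f x ≡ c)
    inClass? x = f x ≟ c
    rest∈cs : All (λ x → f x ∈ cs) (filter (∁? inClass?) xs)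
    rest∈cs = All.zipWith (λ { (here fx≡c , fx≢c) → contradiction fx≡c fx≢c
                             ; (there fx∈cs , _) → fx∈cs })
                          (filter⁺ (∁? inClass?) f∈c∷cs , all-filter (∁? inClass?) xs)

module _ {A : Set} (R : A → A → Set) (R? : Decidable R) where

  maxCliqueExtending : List A → List A → ℕ
  maxCliqueExtending chosen []       = 0
  maxCliqueExtending chosen (x ∷ xs) with All.all? (λ c → R? c x) chosen
  ... | yes _ = maxCliqueExtending chosen xs ⊔ suc (maxCliqueExtending (x ∷ chosen) xs)
  ... | no  _ = maxCliqueExtending chosen xs

  maxCliqueExtending-sound : ∀ chosen {ys xs} → ys ⊆ xs → AllPairs R ys →
                             All (λ y → All (λ c → R c y) chosen) ys →
                             length ys ≤ maxCliqueExtending chosen xs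
  maxCliqueExtending-sound chosen [] [] [] = z≤n
  maxCliqueExtending-sound chosen (x ∷ʳ ys⊆xs) clique ok with All.all? (λ c → R? c x) chosen
  ... | yes _ = ≤-trans (maxCliqueExtending-sound chosen ys⊆xs clique ok) (m≤m⊔n _ _)
  ... | no  _ = maxCliqueExtending-sound chosen ys⊆xs clique ok
  maxCliqueExtending-sound chosen (_∷_ {x = x} refl ys⊆xs) (Rxys ∷ clique) (okx ∷ ok)
    with All.all? (λ c → R? c x) chosen
  ... | no ¬okx = contradiction okx ¬okx
  ... | yes _   = ≤-trans (s≤s (maxCliqueExtending-sound (x ∷ chosen) ys⊆xs clique
                                  (All.zipWith (λ (Rxy , oky) → Rxy ∷ oky) (Rxys , ok))))
                          (m≤n⊔m _ _)

  maxClique-sound : ∀ xs {k} → maxCliqueExtending [] xs ≡ k →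
                    ∀ {ys} → ys ⊆ xs → AllPairs R ys → length ys ≤ k
  maxClique-sound xs refl ys⊆xs clique =
    maxCliqueExtending-sound [] ys⊆xs clique (universal (λ _ → []) _)

P₃⊗C₇ : Graph
P₃⊗C₇ = P 3 ⊗ C 7

vertices : List (V P₃⊗C₇)
vertices = cartesianProduct (allFin 3) (allFin 7)

Far? : Decidable (Far P₃⊗C₇)
Far? u v =
  ¬? (Dist12? (Product.≡-dec Fin._≟_ Fin._≟_) (⊗-Adj? PathAdj? (CycleAdj? 7)) searchFin² u v)

maxPacking-P₃⊗C₇ : maxCliqueExtending (Far P₃⊗C₇) Far? [] vertices ≡ 4
maxPacking-P₃⊗C₇ = refl

packing-P₃⊗C₇ : ∀ {ys} → ys ⊆ vertices → AllPairs (Far P₃⊗C₇) ys → length ys ≤ 4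
packing-P₃⊗C₇ = maxClique-sound (Far P₃⊗C₇) Far? vertices maxPacking-P₃⊗C₇

P₃⊗C₇-noL11Labeling : p < 5 → ¬ HasL11Labeling P₃⊗C₇ p
P₃⊗C₇-noL11Labeling {p} p<5 (l , valid) = <-irrefl refl 21≤20
  where
  open ℕ.≤-Reasoning
  classBound : ∀ c {ys} → ys ⊆ vertices → All (λ y → l y ≡ c) ys → length ys ≤ 4
  classBound c ys⊆vertices same = packing-P₃⊗C₇ ys⊆vertices (sameLabel⇒pairwiseFar valid same)
  21≤20 : 21 ≤ 20
  21≤20 = begin
    length vertices              ≤⟨ length≤classes*bound Fin._≟_ l (allFin (suc p))
                                      (universal (λ v → ∈-allFin (l v)) vertices) classBound ⟩
    length (allFin (suc p)) * 4  ≡⟨ cong (_* 4) (length-tabulate {n = suc p} (λ i → i)) ⟩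
    suc p * 4                    ≤⟨ *-monoˡ-≤ 4 p<5 ⟩
    20                           ∎

rotate : Fin (suc n) → Fin (suc n)
rotate {n} j = suc (toℕ j) mod suc n

toℕ-rotate : (j : Fin (suc n)) → toℕ (rotate j) ≡ suc (toℕ j) % suc n
toℕ-rotate j = toℕ-fromℕ< _

[m%o+n]%o≡[m+n]%o : ∀ m n o .{{_ : NonZero o}} → (m % o + n) % o ≡ (m + n) % o
[m%o+n]%o≡[m+n]%o m n o = begin
  (m % o + n) % o         ≡⟨ %-distribˡ-+ (m % o) n o ⟩
  (m % o % o + n % o) % o ≡⟨ cong (λ k → (k + n % o) % o) (m%n%n≡m%n m o) ⟩
  (m % o + n % o) % o     ≡⟨ sym (%-distribˡ-+ m n o) ⟩
  (m + n) % o             ∎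
  where open ≡-Reasoning

rotate-injective : {i j : Fin (suc n)} → rotate i ≡ rotate j → i ≡ j
rotate-injective {n} {i} {j} eq =
  trans (sym (unrotate-rotate i)) (trans (cong unrotate eq) (unrotate-rotate j))
  where
  unrotate : Fin (suc n) → Fin (suc n)
  unrotate k = (toℕ k + n) mod suc n
  unrotate-rotate : ∀ k → unrotate (rotate k) ≡ k
  unrotate-rotate k = toℕ-injective (begin
    toℕ (unrotate (rotate k))         ≡⟨ toℕ-fromℕ< _ ⟩
    (toℕ (rotate k) + n) % suc n      ≡⟨ cong (λ x → (x + n) % suc n) (toℕ-rotate k) ⟩
    (suc (toℕ k) % suc n + n) % suc n ≡⟨ [m%o+n]%o≡[m+n]%o (suc (toℕ k)) n (suc n) ⟩
    (suc (toℕ k) + n) % suc n         ≡⟨ cong (_% suc n) (sym (+-suc (toℕ k) n)) ⟩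
    (toℕ k + suc n) % suc n           ≡⟨ [m+n]%n≡m%n (toℕ k) (suc n) ⟩
    toℕ k % suc n                     ≡⟨ m<n⇒m%n≡m (toℕ<n k) ⟩
    toℕ k                             ∎)
    where open ≡-Reasoning

CycleAdj-rotate : {i j : Fin (suc n)} →
                  CycleAdj (suc n) i j → CycleAdj (suc n) (rotate i) (rotate j)
CycleAdj-rotate {n} {i} {j} rewrite toℕ-rotate i | toℕ-rotate j =
  Sum.map (cong (λ k → suc k % suc n)) (cong (λ k → suc k % suc n))

CycleAdj-sym : ∀ {i j : Fin (suc n)} → CycleAdj (suc n) i j → CycleAdj (suc n) j i
CycleAdj-sym = Sum.swap

module _ {n p : ℕ} where

  Row : Set
  Row = Fin (suc n) → Fin (suc p)

  next : Row → Row
  next f = rotate ∘ f ∘ rotate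

  row : Row → ℕ → Row
  row f zero    = f
  row f (suc i) = next (row f i)

  diagonalLabeling : Row → V (P m ⊗ C (suc n)) → Fin (suc p)
  diagonalLabeling f (i , j) = row f (toℕ i) j

  record Admissible (f : Row) : Set where
    field
      adjacent-rows  : ∀ j j′ → CycleAdj (suc n) j j′ → f j ≢ next f j′
      rows-two-apart : ∀ j w j′ → CycleAdj (suc n) j w → CycleAdj (suc n) w j′ →
                       f j ≢ next (next f) j′
      same-row       : ∀ j w j′ → CycleAdj (suc n) j w → CycleAdj (suc n) w j′ →
                       j ≢ j′ → f j ≢ f j′
  open Admissible

  Admissible? : U.Decidable Admissible
  Admissible? f =
    map′ (λ (a , b , c) → record { adjacent-rows = a ; rows-two-apart = b ; same-row = c })
         (λ adm → adjacent-rows adm , rows-two-apart adm , same-row adm)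
    ( (all? λ j → all? λ j′ → CycleAdj? _ j j′ →-dec ¬? (f j Fin.≟ next f j′))
    ×-dec (all? λ j → all? λ w → all? λ j′ →
             CycleAdj? _ j w →-dec (CycleAdj? _ w j′ →-dec ¬? (f j Fin.≟ next (next f) j′)))
    ×-dec (all? λ j → all? λ w → all? λ j′ →
             CycleAdj? _ j w →-dec (CycleAdj? _ w j′ →-dec (¬? (j Fin.≟ j′) →-dec ¬? (f j Fin.≟ f j′)))))

  Admissible-next : ∀ {f} → Admissible f → Admissible (next f)
  Admissible-next adm = record
    { adjacent-rows  = λ j j′ jj′ →
        adjacent-rows adm (rotate j) (rotate j′) (CycleAdj-rotate jj′) ∘ rotate-injective
    ; rows-two-apart = λ j w j′ jw wj′ →
        rows-two-apart adm (rotate j) (rotate w) (rotate j′) (CycleAdj-rotate jw) (CycleAdj-rotate wj′)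
          ∘ rotate-injective
    ; same-row       = λ j w j′ jw wj′ j≢j′ →
        same-row adm (rotate j) (rotate w) (rotate j′) (CycleAdj-rotate jw) (CycleAdj-rotate wj′)
                 (j≢j′ ∘ rotate-injective) ∘ rotate-injective
    }

  module _ {f : Row} (adm : Admissible f) where

    Admissible-row : ∀ i → Admissible (row f i)
    Admissible-row zero    = adm
    Admissible-row (suc i) = Admissible-next (Admissible-row i)

    private
      atRow : ∀ {r r′} j → r ≡ r′ → row f r j ≡ row f r′ j
      atRow j r≡r′ = cong (λ r → row f r j) r≡r′

      sameRow : ∀ {i i′ : Fin m} {j w j′} → toℕ i ≡ toℕ i′ → (i , j) ≢ (i′ , j′) →
                CycleAdj (suc n) j w → CycleAdj (suc n) w j′ → row f (toℕ i) j ≢ row f (toℕ i′) j′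
      sameRow {i′ = i′} {j} {w} {j′} i≡i′ u≢v jw wj′ rewrite i≡i′ =
        same-row (Admissible-row (toℕ i′)) j w j′ jw wj′
                 (λ j≡j′ → u≢v (cong₂ _,_ (toℕ-injective i≡i′) j≡j′))

    diagonalLabeling-valid : IsL11Labeling (P m ⊗ C (suc n)) p (diagonalLabeling f)
    diagonalLabeling-valid (i , j) (i′ , j′) (_ , inj₁ (inj₁ e , jj′)) eq =
      adjacent-rows (Admissible-row (toℕ i)) j j′ jj′ (trans eq (atRow j′ (sym e)))
    diagonalLabeling-valid (i , j) (i′ , j′) (_ , inj₁ (inj₂ e , jj′)) eq =
      adjacent-rows (Admissible-row (toℕ i′)) j′ j (CycleAdj-sym jj′) (trans (sym eq) (atRow j (sym e)))
    diagonalLabeling-valid (i , j) (i′ , j′) (_ , inj₂ ((_ , w) , (inj₁ e₁ , jw) , (inj₁ e₂ , wj′))) eq =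
      rows-two-apart (Admissible-row (toℕ i)) j w j′ jw wj′
                     (trans eq (atRow j′ (sym (trans (cong suc e₁) e₂))))
    diagonalLabeling-valid (i , j) (i′ , j′) (_ , inj₂ ((_ , w) , (inj₂ e₁ , jw) , (inj₂ e₂ , wj′))) eq =
      rows-two-apart (Admissible-row (toℕ i′)) j′ w j (CycleAdj-sym wj′) (CycleAdj-sym jw)
                     (trans (sym eq) (atRow j (sym (trans (cong suc e₂) e₁))))
    diagonalLabeling-valid _ _ (u≢v , inj₂ (_ , (inj₁ e₁ , jw) , (inj₂ e₂ , wj′))) =
      sameRow (suc-injective (trans e₁ (sym e₂))) u≢v jw wj′
    diagonalLabeling-valid _ _ (u≢v , inj₂ (_ , (inj₂ e₁ , jw) , (inj₁ e₂ , wj′))) =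
      sameRow (trans (sym e₁) e₂) u≢v jw wj′

seed : Fin 7 → Fin 6
seed = lookup (# 0 ∷ # 0 ∷ # 1 ∷ # 3 ∷ # 3 ∷ # 5 ∷ # 4 ∷ [])

seed-admissible : Admissible seed
seed-admissible = toWitness {a? = Admissible? seed} tt

mainTheorem13 : (m : ℕ) → 3 ≤ m → Lambda11≡ (P m ⊗ C 7) 5
mainTheorem13 m 3≤m =
  (diagonalLabeling seed , diagonalLabeling-valid seed-admissible) ,
  λ q hasLabeling → ≮⇒≥ λ q<5 →
    P₃⊗C₇-noL11Labeling q<5 (HasL11Labeling-↪ (⊗-↪ˡ (P-↪ 3≤m)) hasLabeling)
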